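{- There are recursively defined translations $(\cdot)^{nf}:\mathcal{L}_{Full}\to\mathcal{L}_{NF}$ and $(\cdot)^{par}:\mathcal{L}_{Full}\to\mathcal{L}_{Par}$ that are truth-preserving, i.e. for every $\varphi\in\mathcal{L}_{Full}$ and every game model $\mathbb{S}$, $[\![\varphi^{nf}]\!]^{\mathbb{S}}=[\![\varphi]\!]^{\mathbb{S}}=[\![\varphi^{par}]\!]^{\mathbb{S}}$.
   Context: Fix countable sets $\mathsf{P}_0$, $\mathsf{G}_0$. $\mathcal{L}_{Par}$/$\mathcal{G}_{Par}$: $\varphi ::= p \mid \neg\varphi \mid \varphi\lor\varphi \mid \langle\gamma\rangle\varphi$, $\gamma ::= g \mid \gamma;\gamma \mid \gamma\sqcup\gamma \mid \gamma^* \mid \gamma^d \mid \varphi?$. $\mathcal{L}_{NF}$/$\mathcal{G}_{NF}$: $\varphi ::= p \mid \neg p \mid \varphi\lor\varphi \mid \varphi\land\varphi \mid \langle\gamma\rangle\varphi$, $\gamma ::= g \mid g^d \mid \gamma;\gamma \mid \gamma\sqcup\gamma \mid \gamma\sqcap\gamma \mid \gamma^* \mid \gamma^\times \mid \varphi? \mid \varphi!$. $\mathcal{L}_{Full}$/$\mathcal{G}_{Full}$ (all connectives and game constructors, duals and negations placed freely): $\varphi ::= p \mid \neg\varphi \mid \varphi\lor\varphi \mid \langle\gamma\rangle\varphi$, $\gamma ::= g \mid \gamma;\gamma \mid \gamma\sqcup\gamma \mid \gamma\sqcap\gamma \mid \gamma^* \mid \gamma^\times \mid \gamma^d \mid \varphi?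 \mid \varphi!$, with $\land,\to,\leftrightarrow$ as abbreviations. Game model $\mathbb{S}=(S,E,V)$: $V:\mathsf{P}_0\to\wp(S)$, $E(g):\wp(S)\to\wp(S)$ monotone; $[\![p]\!]=V(p)$, $[\![\neg\varphi]\!]=S\setminus[\![\varphi]\!]$, $\lor,\land$ as $\cup,\cap$, $[\![\langle\gamma\rangle\varphi]\!]=\hat E_\gamma([\![\varphi]\!])$ with $\hat E_g=E(g)$, $\hat E_{\gamma^d}(X)=S\setminus\hat E_\gamma(S\setminus X)$, $\hat E_{\gamma;\delta}=\hat E_\gamma\circ\hat E_\delta$, $\hat E_{\gamma\sqcup\delta}(X)=\hat E_\gamma(X)\cup\hat E_\delta(X)$, $\hat E_{\gamma\sqcap\delta}(X)=\hat E_\gamma(X)\cap\hat E_\delta(X)$, $\hat E_{\gamma^*}(X)=$ lfp of $Y\mapsto X\cup\hat E_\gamma(Y)$, $\hat E_{\gamma^\times}(X)=$ gfp of $Y\mapsto X\cap\hat E_\gamma(Y)$, $\hat E_{\varphi?}(X)=[\![\varphi]\!]\cap X$, $\hat E_{\varphi!}(X)=[\![\varphi]\!]\cup X$. -}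

module Defs where

open import Level using (Level; 0ℓ; _⊔_; Setω) renaming (suc to lsuc)
open import Data.Nat using (ℕ)
open import Data.Product using (Σ; _×_)
open import Relation.Nullary using (Dec)
open import Relation.Unary using (Pred; _⊆_; _∪_; _∩_; ∁)

-- Atomic propositions P₀ and atomic games G₀: countable, fixed as ℕ.
Prop₀ : Set
Prop₀ = ℕ

Game₀ : Set
Game₀ = ℕ

mutual
  data FmFull : Set where
    atom : Prop₀ → FmFull
    neg  : FmFull → FmFull
    _∨_  : FmFull → FmFull → FmFull
    ⟨_⟩_ : GmFull → FmFull → FmFull

  data GmFull : Set where
    gatom  : Game₀ → GmFull
    _⨾_    : GmFull → GmFull → GmFull
    _⊔g_   : GmFull → GmFull → GmFull
    _⊓g_   : GmFull → GmFull → GmFull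
    _*     : GmFull → GmFull
    _ˣ     : GmFull → GmFull
    _ᵈ     : GmFull → GmFull
    _¿     : FmFull → GmFull     -- test   φ?
    _¡     : FmFull → GmFull     -- dual test φ!

mutual
  data FmPar : Set where
    atom : Prop₀ → FmPar
    neg  : FmPar → FmPar
    _∨_  : FmPar → FmPar → FmPar
    ⟨_⟩_ : GmPar → FmPar → FmPar

  data GmPar : Set where
    gatom : Game₀ → GmPar
    _⨾_   : GmPar → GmPar → GmPar
    _⊔g_  : GmPar → GmPar → GmPar
    _*    : GmPar → GmPar
    _ᵈ    : GmPar → GmPar
    _¿    : FmPar → GmPar

mutual
  data FmNF : Set where
    atom    : Prop₀ → FmNF
    negatom : Prop₀ → FmNF
    _∨_     : FmNF → FmNF → FmNF
    _∧_     : FmNF → FmNF → FmNF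
    ⟨_⟩_    : GmNF → FmNF → FmNF

  data GmNF : Set where
    gatom  : Game₀ → GmNF
    gdual  : Game₀ → GmNF
    _⨾_    : GmNF → GmNF → GmNF
    _⊔g_   : GmNF → GmNF → GmNF
    _⊓g_   : GmNF → GmNF → GmNF
    _*     : GmNF → GmNF
    _ˣ     : GmNF → GmNF
    _¿     : FmNF → GmNF
    _¡     : FmNF → GmNF

-- Subsets of S are predicates S → Set ℓ; the effectivity
-- function E(g) acts on subsets of every universe level, and is monotone
-- with respect to (level-heterogeneous) inclusion, which also makes it
-- coherent across levels (it is one function on ℘(S)).

record GameModel : Setω where
  field
    S    : Set
    V    : Prop₀ → Pred S 0ℓ
    E    : Game₀ → ∀ {ℓ} → Pred S ℓ → Pred S ℓ
    mono : ∀ g {a b} {X : Pred S a} {Y : Pred S b} → X ⊆ Y → E g X ⊆ E g Y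

_≐_ : ∀ {A : Set} {a b} → Pred A a → Pred A b → Set _
X ≐ Y = X ⊆ Y × Y ⊆ X

-- Least / greatest fixed points of Y ↦ X ∪ F Y and Y ↦ X ∩ F Y,
-- as intersection of prefixed points / union of postfixed points.
lfpStep : ∀ {A : Set} {ℓ k} → Pred A ℓ → (Pred A ℓ → Pred A k) → Pred A (lsuc ℓ ⊔ k)
lfpStep {ℓ = ℓ} X F = λ s → ∀ (Y : Pred _ ℓ) → X ⊆ Y → F Y ⊆ Y → Y s

gfpStep : ∀ {A : Set} {ℓ k} → Pred A ℓ → (Pred A ℓ → Pred A k) → Pred A (lsuc ℓ ⊔ k)
gfpStep {ℓ = ℓ} X F = λ s → Σ (Pred _ ℓ) (λ Y → Y ⊆ X × Y ⊆ F Y × Y s)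

module Semantics (M : GameModel) where
  open GameModel M

  mutual
    lvF : FmFull → Level
    lvF (atom p)  = 0ℓ
    lvF (neg φ)   = lvF φ
    lvF (φ ∨ ψ)   = lvF φ ⊔ lvF ψ
    lvF (⟨ γ ⟩ φ) = outF γ (lvF φ)

    outF : GmFull → Level → Level
    outF (gatom g) ℓ = ℓ
    outF (γ ⨾ δ)  ℓ = outF γ (outF δ ℓ)
    outF (γ ⊔g δ) ℓ = outF γ ℓ ⊔ outF δ ℓ
    outF (γ ⊓g δ) ℓ = outF γ ℓ ⊔ outF δ ℓ
    outF (γ *)    ℓ = lsuc ℓ ⊔ outF γ ℓ
    outF (γ ˣ)    ℓ = lsuc ℓ ⊔ outF γ ℓ
    outF (γ ᵈ)    ℓ = outF γ ℓ
    outF (φ ¿)    ℓ = lvF φ ⊔ ℓ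
    outF (φ ¡)    ℓ = lvF φ ⊔ ℓ

    ⟦_⟧F : (φ : FmFull) → Pred S (lvF φ)
    ⟦ atom p ⟧F  = V p
    ⟦ neg φ ⟧F   = ∁ ⟦ φ ⟧F
    ⟦ φ ∨ ψ ⟧F   = ⟦ φ ⟧F ∪ ⟦ ψ ⟧F
    ⟦ ⟨ γ ⟩ φ ⟧F = ÊF γ ⟦ φ ⟧F

    ÊF : (γ : GmFull) → ∀ {ℓ} → Pred S ℓ → Pred S (outF γ ℓ)
    ÊF (gatom g) X = E g X
    ÊF (γ ⨾ δ)  X = ÊF γ (ÊF δ X)
    ÊF (γ ⊔g δ) X = ÊF γ X ∪ ÊF δ X
    ÊF (γ ⊓g δ) X = ÊF γ X ∩ ÊF δ X
    ÊF (γ *)    X = lfpStep X (ÊF γ)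
    ÊF (γ ˣ)    X = gfpStep X (ÊF γ)
    ÊF (γ ᵈ)    X = ∁ (ÊF γ (∁ X))
    ÊF (φ ¿)    X = ⟦ φ ⟧F ∩ X
    ÊF (φ ¡)    X = ⟦ φ ⟧F ∪ X

  mutual
    lvP : FmPar → Level
    lvP (atom p)  = 0ℓ
    lvP (neg φ)   = lvP φ
    lvP (φ ∨ ψ)   = lvP φ ⊔ lvP ψ
    lvP (⟨ γ ⟩ φ) = outP γ (lvP φ)

    outP : GmPar → Level → Level
    outP (gatom g) ℓ = ℓ
    outP (γ ⨾ δ)  ℓ = outP γ (outP δ ℓ)
    outP (γ ⊔g δ) ℓ = outP γ ℓ ⊔ outP δ ℓ
    outP (γ *)    ℓ = lsuc ℓ ⊔ outP γ ℓ
    outP (γ ᵈ)    ℓ = outP γ ℓ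
    outP (φ ¿)    ℓ = lvP φ ⊔ ℓ

    ⟦_⟧P : (φ : FmPar) → Pred S (lvP φ)
    ⟦ atom p ⟧P  = V p
    ⟦ neg φ ⟧P   = ∁ ⟦ φ ⟧P
    ⟦ φ ∨ ψ ⟧P   = ⟦ φ ⟧P ∪ ⟦ ψ ⟧P
    ⟦ ⟨ γ ⟩ φ ⟧P = ÊP γ ⟦ φ ⟧P

    ÊP : (γ : GmPar) → ∀ {ℓ} → Pred S ℓ → Pred S (outP γ ℓ)
    ÊP (gatom g) X = E g X
    ÊP (γ ⨾ δ)  X = ÊP γ (ÊP δ X)
    ÊP (γ ⊔g δ) X = ÊP γ X ∪ ÊP δ X
    ÊP (γ *)    X = lfpStep X (ÊP γ)
    ÊP (γ ᵈ)    X = ∁ (ÊP γ (∁ X))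
    ÊP (φ ¿)    X = ⟦ φ ⟧P ∩ X

  mutual
    lvN : FmNF → Level
    lvN (atom p)    = 0ℓ
    lvN (negatom p) = 0ℓ
    lvN (φ ∨ ψ)     = lvN φ ⊔ lvN ψ
    lvN (φ ∧ ψ)     = lvN φ ⊔ lvN ψ
    lvN (⟨ γ ⟩ φ)   = outN γ (lvN φ)

    outN : GmNF → Level → Level
    outN (gatom g) ℓ = ℓ
    outN (gdual g) ℓ = ℓ
    outN (γ ⨾ δ)  ℓ = outN γ (outN δ ℓ)
    outN (γ ⊔g δ) ℓ = outN γ ℓ ⊔ outN δ ℓ
    outN (γ ⊓g δ) ℓ = outN γ ℓ ⊔ outN δ ℓ
    outN (γ *)    ℓ = lsuc ℓ ⊔ outN γ ℓ
    outN (γ ˣ)    ℓ = lsuc ℓ ⊔ outN γ ℓ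
    outN (φ ¿)    ℓ = lvN φ ⊔ ℓ
    outN (φ ¡)    ℓ = lvN φ ⊔ ℓ

    ⟦_⟧N : (φ : FmNF) → Pred S (lvN φ)
    ⟦ atom p ⟧N    = V p
    ⟦ negatom p ⟧N = ∁ (V p)
    ⟦ φ ∨ ψ ⟧N     = ⟦ φ ⟧N ∪ ⟦ ψ ⟧N
    ⟦ φ ∧ ψ ⟧N     = ⟦ φ ⟧N ∩ ⟦ ψ ⟧N
    ⟦ ⟨ γ ⟩ φ ⟧N   = ÊN γ ⟦ φ ⟧N

    ÊN : (γ : GmNF) → ∀ {ℓ} → Pred S ℓ → Pred S (outN γ ℓ)
    ÊN (gatom g) X = E g X
    ÊN (gdual g) X = ∁ (E g (∁ X))
    ÊN (γ ⨾ δ)  X = ÊN γ (ÊN δ X)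
    ÊN (γ ⊔g δ) X = ÊN γ X ∪ ÊN δ X
    ÊN (γ ⊓g δ) X = ÊN γ X ∩ ÊN δ X
    ÊN (γ *)    X = lfpStep X (ÊN γ)
    ÊN (γ ˣ)    X = gfpStep X (ÊN γ)
    ÊN (φ ¿)    X = ⟦ φ ⟧N ∩ X
    ÊN (φ ¡)    X = ⟦ φ ⟧N ∪ X

Classical : Setω
Classical = ∀ {ℓ} (A : Set ℓ) → Dec A

record TruthPreservingTranslations : Setω where
  field
    nf  : FmFull → FmNF
    par : FmFull → FmPar
    nf-sound  : Classical → ∀ (M : GameModel) (φ : FmFull) →
                let open Semantics M in ⟦ nf φ ⟧N ≐ ⟦ φ ⟧F
    par-sound : Classical → ∀ (M : GameModel) (φ : FmFull) →
                let open Semantics M in ⟦ φ ⟧F ≐ ⟦ par φ ⟧P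

-- Both translations rest on the De Morgan dualities of game logic: the dual
-- of γ ⊔ δ is γᵈ ⊓ δᵈ, of γ* is (γᵈ)ˣ, of φ? is (¬ φ)!, and conversely.
-- nf pushes duals and negations down to atomic games and propositions along
-- these dualities; par instead eliminates ⊓, ˣ and ! by writing each as the
-- dual of its partner.  Every game operation is monotone, so its semantics
-- respects extensional equality of subsets, and the only non-local case of
-- the structural induction is the fixed-point duality
--   ∁ (lfp Y. ∁ X ∪ F Y) = gfp Y. X ∩ Fᵈ Y,   where Fᵈ X = ∁ (F (∁ X)).
-- Classical logic enters through double negation and through moving
-- predicates between universe levels.
module Submission where

open import Level using (Level; _⊔_; Lift; lift; lower; Setω) renaming (suc to lsuc)
open import Data.Product using (_,_; proj₁; proj₂)
open import Data.Sum using (inj₁; inj₂)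
open import Function using (id)
open import Relation.Nullary using (¬_)
open import Relation.Nullary.Decidable using (True; toWitness; fromWitness; decidable-stable)
open import Relation.Unary using (Pred; _⊆_; _∪_; _∩_; ∁)
open import Relation.Unary.Properties using (≐-refl; ≐-sym; ≐-trans)

open import Defs

module ClassicalPredicates {S : Set} (lem : Classical) where

  ¬¬-elim : ∀ {ℓ} {A : Set ℓ} → ¬ ¬ A → A
  ¬¬-elim {A = A} = decidable-stable (lem A)

  ≐∁∁ : ∀ {a} {X : Pred S a} → X ≐ ∁ (∁ X)
  ≐∁∁ = (λ x ¬x → ¬x x) , ¬¬-elim

  ∁-cong : ∀ {a b} {X : Pred S a} {Y : Pred S b} → X ≐ Y → ∁ X ≐ ∁ Y
  ∁-cong (X⊆Y , Y⊆X) = (λ ¬x y → ¬x (Y⊆X y)) , (λ ¬y x → ¬y (X⊆Y x))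

  ∪-cong : ∀ {a b c d} {X : Pred S a} {Y : Pred S b} {Z : Pred S c} {W : Pred S d} →
           X ≐ Y → Z ≐ W → (X ∪ Z) ≐ (Y ∪ W)
  ∪-cong (X⊆Y , Y⊆X) (Z⊆W , W⊆Z) =
    (λ { (inj₁ x) → inj₁ (X⊆Y x) ; (inj₂ z) → inj₂ (Z⊆W z) }) ,
    (λ { (inj₁ y) → inj₁ (Y⊆X y) ; (inj₂ w) → inj₂ (W⊆Z w) })

  ∩-cong : ∀ {a b c d} {X : Pred S a} {Y : Pred S b} {Z : Pred S c} {W : Pred S d} →
           X ≐ Y → Z ≐ W → (X ∩ Z) ≐ (Y ∩ W)
  ∩-cong (X⊆Y , Y⊆X) (Z⊆W , W⊆Z) =
    (λ (x , z) → X⊆Y x , Z⊆W z) , (λ (y , w) → Y⊆X y , W⊆Z w)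

  ∁-∪ : ∀ {a b} {X : Pred S a} {Y : Pred S b} → ∁ (X ∪ Y) ≐ (∁ X ∩ ∁ Y)
  ∁-∪ = (λ ¬x∪y → (λ x → ¬x∪y (inj₁ x)) , (λ y → ¬x∪y (inj₂ y))) ,
        (λ { (¬x , ¬y) (inj₁ x) → ¬x x ; (¬x , ¬y) (inj₂ y) → ¬y y })

  ∁-∩ : ∀ {a b} {X : Pred S a} {Y : Pred S b} → ∁ (X ∩ Y) ≐ (∁ X ∪ ∁ Y)
  ∁-∩ = (λ ¬x∩y → ¬¬-elim λ k → k (inj₁ λ x → k (inj₂ λ y → ¬x∩y (x , y)))) ,
        (λ { (inj₁ ¬x) (x , y) → ¬x x ; (inj₂ ¬y) (x , y) → ¬y y })

  ∩≐∁[∁∪∁] : ∀ {a b} {X : Pred S a} {Y : Pred S b} → (X ∩ Y) ≐ ∁ (∁ X ∪ ∁ Y)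
  ∩≐∁[∁∪∁] = ≐-trans ≐∁∁ (∁-cong ∁-∩)

  ∪≐∁[∁∩∁] : ∀ {a b} {X : Pred S a} {Y : Pred S b} → (X ∪ Y) ≐ ∁ (∁ X ∩ ∁ Y)
  ∪≐∁[∁∩∁] = ≐-trans ≐∁∁ (∁-cong ∁-∪)

  -- Excluded middle makes every predicate equivalent to one at any level.
  resize : ∀ ℓ {b} → Pred S b → Pred S ℓ
  resize ℓ Z s = Lift ℓ (True (lem (Z s)))

  ⊆resize : ∀ ℓ {b} (Z : Pred S b) → Z ⊆ resize ℓ Z
  ⊆resize ℓ Z z = lift (fromWitness z)

  resize⊆ : ∀ ℓ {b} (Z : Pred S b) → resize ℓ Z ⊆ Z
  resize⊆ ℓ Z r = toWitness (lower r)

  Transformer : (Level → Level) → Setω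
  Transformer o = ∀ {ℓ} → Pred S ℓ → Pred S (o ℓ)

  Monotone : ∀ {o} → Transformer o → Setω
  Monotone F = ∀ {a b} {X : Pred S a} {Y : Pred S b} → X ⊆ Y → F X ⊆ F Y

  infix 4 _≃_
  _≃_ : ∀ {o o′} → Transformer o → Transformer o′ → Setω
  F ≃ G = ∀ {a b} {X : Pred S a} {Y : Pred S b} → X ≐ Y → F X ≐ G Y

  dual : ∀ {o} → Transformer o → Transformer o
  dual F X = ∁ (F (∁ X))

  star : ∀ {o} → Transformer o → Transformer (λ ℓ → lsuc ℓ ⊔ o ℓ)
  star F X = lfpStep X F

  cross : ∀ {o} → Transformer o → Transformer (λ ℓ → lsuc ℓ ⊔ o ℓ)
  cross F X = gfpStep X F

  module _ {o} {F : Transformer o} (F-mono : Monotone F) where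

    ⊆-lfp : ∀ {a} {X : Pred S a} → X ⊆ star F X
    ⊆-lfp x Y X⊆Y FY⊆Y = X⊆Y x

    lfp-closed : ∀ {a} {X : Pred S a} → F (star F X) ⊆ star F X
    lfp-closed f Y X⊆Y FY⊆Y = FY⊆Y (F-mono (λ l → l Y X⊆Y FY⊆Y) f)

    -- lfpStep only quantifies over prefixed points at the level of X, so Z is
    -- first resized to that level.
    lfp-induction : ∀ {a b} {X : Pred S a} {Z : Pred S b} →
                    X ⊆ Z → F Z ⊆ Z → star F X ⊆ Z
    lfp-induction {a} {Z = Z} X⊆Z FZ⊆Z l =
      resize⊆ a Z (l (resize a Z) (λ x → ⊆resize a Z (X⊆Z x))
                                (λ f → ⊆resize a Z (FZ⊆Z (F-mono (resize⊆ a Z) f))))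

    gfp-⊆ : ∀ {a} {X : Pred S a} → cross F X ⊆ X
    gfp-⊆ (Y , Y⊆X , Y⊆FY , y) = Y⊆X y

    gfp-unfold : ∀ {a} {X : Pred S a} → cross F X ⊆ F (cross F X)
    gfp-unfold (Y , Y⊆X , Y⊆FY , y) =
      F-mono (λ y′ → Y , (λ {s} → Y⊆X {s}) , (λ {s} → Y⊆FY {s}) , y′) (Y⊆FY y)

    gfp-coinduction : ∀ {a b} {X : Pred S a} {Z : Pred S b} →
                      Z ⊆ X → Z ⊆ F Z → Z ⊆ cross F X
    gfp-coinduction {a} {Z = Z} Z⊆X Z⊆FZ z =
      resize a Z , (λ r → Z⊆X (resize⊆ a Z r)) ,
      (λ r → F-mono (⊆resize a Z) (Z⊆FZ (resize⊆ a Z r))) , ⊆resize a Z z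

  module _ {o o′} {F : Transformer o} {G : Transformer o′} where

    lfp-mono : Monotone F → Monotone G → (∀ {a} {X : Pred S a} → F X ⊆ G X) →
               ∀ {a b} {X : Pred S a} {Y : Pred S b} → X ⊆ Y → star F X ⊆ star G Y
    lfp-mono F-mono G-mono F⊆G X⊆Y =
      lfp-induction F-mono (λ x → ⊆-lfp G-mono (X⊆Y x)) (λ f → lfp-closed G-mono (F⊆G f))

    gfp-mono : Monotone F → Monotone G → (∀ {a} {X : Pred S a} → F X ⊆ G X) →
               ∀ {a b} {X : Pred S a} {Y : Pred S b} → X ⊆ Y → cross F X ⊆ cross G Y
    gfp-mono F-mono G-mono F⊆G X⊆Y =
      gfp-coinduction G-mono (λ c → X⊆Y (gfp-⊆ F-mono c)) (λ c → F⊆G (gfp-unfold F-mono c))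

  module _ {o} {F : Transformer o} where

    ≃-refl : Monotone F → F ≃ F
    ≃-refl F-mono (X⊆Y , Y⊆X) = F-mono X⊆Y , F-mono Y⊆X

    star-mono : Monotone F → Monotone (star F)
    star-mono F-mono = lfp-mono F-mono F-mono id

    cross-mono : Monotone F → Monotone (cross F)
    cross-mono F-mono = gfp-mono F-mono F-mono id

    dual-mono : Monotone F → Monotone (dual F)
    dual-mono F-mono X⊆Y ¬F∁X F∁Y = ¬F∁X (F-mono (λ ¬y x → ¬y (X⊆Y x)) F∁Y)

    dual-involutive : Monotone F → dual (dual F) ≃ F
    dual-involutive F-mono X≐Y =
      ≐-trans (≐-sym ≐∁∁) (≃-refl F-mono (≐-trans (≐-sym ≐∁∁) X≐Y))

  module _ {o o′} {F : Transformer o} {G : Transformer o′} where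

    ≃-sym : F ≃ G → G ≃ F
    ≃-sym F≃G X≐Y = ≐-sym (F≃G (≐-sym X≐Y))

    dual-cong : F ≃ G → dual F ≃ dual G
    dual-cong F≃G X≐Y = ∁-cong (F≃G (∁-cong X≐Y))

    star-cong : Monotone F → Monotone G → F ≃ G → star F ≃ star G
    star-cong F-mono G-mono F≃G (X⊆Y , Y⊆X) =
      lfp-mono F-mono G-mono (proj₁ (F≃G ≐-refl)) X⊆Y ,
      lfp-mono G-mono F-mono (proj₂ (F≃G ≐-refl)) Y⊆X

    cross-cong : Monotone F → Monotone G → F ≃ G → cross F ≃ cross G
    cross-cong F-mono G-mono F≃G (X⊆Y , Y⊆X) =
      gfp-mono F-mono G-mono (proj₁ (F≃G ≐-refl)) X⊆Y ,
      gfp-mono G-mono F-mono (proj₂ (F≃G ≐-refl)) Y⊆X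

  ≃-trans : ∀ {o o′ o″} {F : Transformer o} {G : Transformer o′} {H : Transformer o″} →
            F ≃ G → G ≃ H → F ≃ H
  ≃-trans F≃G G≃H X≐Y = ≐-trans (F≃G X≐Y) (G≃H ≐-refl)

  dual-swap : ∀ {o o′} {F : Transformer o} {G : Transformer o′} →
              Monotone F → dual F ≃ G → dual G ≃ F
  dual-swap F-mono dualF≃G = ≃-trans (dual-cong (≃-sym dualF≃G)) (dual-involutive F-mono)

  dual-star : ∀ {o o′} {F : Transformer o} {G : Transformer o′} →
              Monotone F → Monotone G → dual F ≃ G → dual (star F) ≃ cross G
  dual-star {F = F} {G} F-mono G-mono dualF≃G {X = X} {Y} (X⊆Y , Y⊆X) = ∁lfp⊆gfp , gfp⊆∁lfp
    where
    ∁lfp⊆gfp : dual (star F) X ⊆ cross G Y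
    ∁lfp⊆gfp = gfp-coinduction G-mono {Z = dual (star F) X}
      (λ ¬l → ¬¬-elim λ ¬y → ¬l (⊆-lfp F-mono λ x → ¬y (X⊆Y x)))
      (λ ¬l → proj₁ (dualF≃G ≐-refl) λ f → ¬l (lfp-closed F-mono (F-mono ¬¬-elim f)))

    gfp⊆∁lfp : cross G Y ⊆ dual (star F) X
    gfp⊆∁lfp c l = lfp-induction F-mono {Z = ∁ (cross G Y)}
      (λ ¬x c′ → ¬x (Y⊆X (gfp-⊆ G-mono c′)))
      (λ f c′ → proj₂ (dualF≃G ≐-refl) (gfp-unfold G-mono c′) f)
      l c

  dual-cross : ∀ {o o′} {F : Transformer o} {G : Transformer o′} →
               Monotone F → Monotone G → dual F ≃ G → dual (cross F) ≃ star G
  dual-cross F-mono G-mono dualF≃G =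
    ≃-trans (dual-cong (≃-sym (dual-star G-mono F-mono (dual-swap F-mono dualF≃G))))
            (dual-involutive (star-mono G-mono))

mutual
  par : FmFull → FmPar
  par (atom p)  = atom p
  par (neg φ)   = neg (par φ)
  par (φ ∨ ψ)   = par φ ∨ par ψ
  par (⟨ γ ⟩ φ) = ⟨ parᵍ γ ⟩ par φ

  parᵍ : GmFull → GmPar
  parᵍ (gatom g) = gatom g
  parᵍ (γ ⨾ δ)  = parᵍ γ ⨾ parᵍ δ
  parᵍ (γ ⊔g δ) = parᵍ γ ⊔g parᵍ δ
  parᵍ (γ ⊓g δ) = ((parᵍ γ ᵈ) ⊔g (parᵍ δ ᵈ)) ᵈ
  parᵍ (γ *)    = parᵍ γ *
  parᵍ (γ ˣ)    = ((parᵍ γ ᵈ) *) ᵈ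
  parᵍ (γ ᵈ)    = parᵍ γ ᵈ
  parᵍ (φ ¿)    = par φ ¿
  parᵍ (φ ¡)    = (neg (par φ) ¿) ᵈ

mutual
  nf : FmFull → FmNF
  nf (atom p)  = atom p
  nf (neg φ)   = nf¬ φ
  nf (φ ∨ ψ)   = nf φ ∨ nf ψ
  nf (⟨ γ ⟩ φ) = ⟨ nfᵍ γ ⟩ nf φ

  nf¬ : FmFull → FmNF
  nf¬ (atom p)  = negatom p
  nf¬ (neg φ)   = nf φ
  nf¬ (φ ∨ ψ)   = nf¬ φ ∧ nf¬ ψ
  nf¬ (⟨ γ ⟩ φ) = ⟨ nfᵍᵈ γ ⟩ nf¬ φ

  nfᵍ : GmFull → GmNF
  nfᵍ (gatom g) = gatom g
  nfᵍ (γ ⨾ δ)  = nfᵍ γ ⨾ nfᵍ δ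
  nfᵍ (γ ⊔g δ) = nfᵍ γ ⊔g nfᵍ δ
  nfᵍ (γ ⊓g δ) = nfᵍ γ ⊓g nfᵍ δ
  nfᵍ (γ *)    = nfᵍ γ *
  nfᵍ (γ ˣ)    = nfᵍ γ ˣ
  nfᵍ (γ ᵈ)    = nfᵍᵈ γ
  nfᵍ (φ ¿)    = nf φ ¿
  nfᵍ (φ ¡)    = nf φ ¡

  nfᵍᵈ : GmFull → GmNF
  nfᵍᵈ (gatom g) = gdual g
  nfᵍᵈ (γ ⨾ δ)  = nfᵍᵈ γ ⨾ nfᵍᵈ δ
  nfᵍᵈ (γ ⊔g δ) = nfᵍᵈ γ ⊓g nfᵍᵈ δ
  nfᵍᵈ (γ ⊓g δ) = nfᵍᵈ γ ⊔g nfᵍᵈ δ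
  nfᵍᵈ (γ *)    = nfᵍᵈ γ ˣ
  nfᵍᵈ (γ ˣ)    = nfᵍᵈ γ *
  nfᵍᵈ (γ ᵈ)    = nfᵍ γ
  nfᵍᵈ (φ ¿)    = nf¬ φ ¡
  nfᵍᵈ (φ ¡)    = nf¬ φ ¿

module Soundness (lem : Classical) (M : GameModel) where
  open GameModel M
  open Semantics M
  open ClassicalPredicates {S} lem

  ÊF-mono : ∀ γ → Monotone (ÊF γ)
  ÊF-mono (gatom g) = mono g
  ÊF-mono (γ ⨾ δ)  X⊆Y = ÊF-mono γ (ÊF-mono δ X⊆Y)
  ÊF-mono (γ ⊔g δ) X⊆Y (inj₁ x) = inj₁ (ÊF-mono γ X⊆Y x)
  ÊF-mono (γ ⊔g δ) X⊆Y (inj₂ x) = inj₂ (ÊF-mono δ X⊆Y x)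
  ÊF-mono (γ ⊓g δ) X⊆Y (x , x′) = ÊF-mono γ X⊆Y x , ÊF-mono δ X⊆Y x′
  ÊF-mono (γ *)    = star-mono (ÊF-mono γ)
  ÊF-mono (γ ˣ)    = cross-mono (ÊF-mono γ)
  ÊF-mono (γ ᵈ)    = dual-mono (ÊF-mono γ)
  ÊF-mono (φ ¿)    X⊆Y (t , x) = t , X⊆Y x
  ÊF-mono (φ ¡)    X⊆Y (inj₁ t) = inj₁ t
  ÊF-mono (φ ¡)    X⊆Y (inj₂ x) = inj₂ (X⊆Y x)

  ÊP-mono : ∀ γ → Monotone (ÊP γ)
  ÊP-mono (gatom g) = mono g
  ÊP-mono (γ ⨾ δ)  X⊆Y = ÊP-mono γ (ÊP-mono δ X⊆Y)
  ÊP-mono (γ ⊔g δ) X⊆Y (inj₁ x) = inj₁ (ÊP-mono γ X⊆Y x)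
  ÊP-mono (γ ⊔g δ) X⊆Y (inj₂ x) = inj₂ (ÊP-mono δ X⊆Y x)
  ÊP-mono (γ *)    = star-mono (ÊP-mono γ)
  ÊP-mono (γ ᵈ)    = dual-mono (ÊP-mono γ)
  ÊP-mono (φ ¿)    X⊆Y (t , x) = t , X⊆Y x

  ÊN-mono : ∀ γ → Monotone (ÊN γ)
  ÊN-mono (gatom g) = mono g
  ÊN-mono (gdual g) = dual-mono (mono g)
  ÊN-mono (γ ⨾ δ)  X⊆Y = ÊN-mono γ (ÊN-mono δ X⊆Y)
  ÊN-mono (γ ⊔g δ) X⊆Y (inj₁ x) = inj₁ (ÊN-mono γ X⊆Y x)
  ÊN-mono (γ ⊔g δ) X⊆Y (inj₂ x) = inj₂ (ÊN-mono δ X⊆Y x)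
  ÊN-mono (γ ⊓g δ) X⊆Y (x , x′) = ÊN-mono γ X⊆Y x , ÊN-mono δ X⊆Y x′
  ÊN-mono (γ *)    = star-mono (ÊN-mono γ)
  ÊN-mono (γ ˣ)    = cross-mono (ÊN-mono γ)
  ÊN-mono (φ ¿)    X⊆Y (t , x) = t , X⊆Y x
  ÊN-mono (φ ¡)    X⊆Y (inj₁ t) = inj₁ t
  ÊN-mono (φ ¡)    X⊆Y (inj₂ x) = inj₂ (X⊆Y x)

  mutual
    par-sound : ∀ φ → ⟦ φ ⟧F ≐ ⟦ par φ ⟧P
    par-sound (atom p)  = ≐-refl
    par-sound (neg φ)   = ∁-cong (par-sound φ)
    par-sound (φ ∨ ψ)   = ∪-cong (par-sound φ) (par-sound ψ)
    par-sound (⟨ γ ⟩ φ) = parᵍ-sound γ (par-sound φ)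

    parᵍ-sound : ∀ γ → ÊF γ ≃ ÊP (parᵍ γ)
    parᵍ-sound (gatom g) = ≃-refl (mono g)
    parᵍ-sound (γ ⨾ δ)  X≐Y = parᵍ-sound γ (parᵍ-sound δ X≐Y)
    parᵍ-sound (γ ⊔g δ) X≐Y = ∪-cong (parᵍ-sound γ X≐Y) (parᵍ-sound δ X≐Y)
    parᵍ-sound (γ ⊓g δ) X≐Y =
      ≐-trans (∩-cong (parᵍ-sound γ (≐-trans X≐Y ≐∁∁)) (parᵍ-sound δ (≐-trans X≐Y ≐∁∁)))
              ∩≐∁[∁∪∁]
    parᵍ-sound (γ *)    = star-cong (ÊF-mono γ) (ÊP-mono (parᵍ γ)) (parᵍ-sound γ)
    parᵍ-sound (γ ˣ)    = ≃-sym (dual-star (ÊP-mono (parᵍ γ ᵈ)) (ÊF-mono γ)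
      (≃-trans (dual-involutive (ÊP-mono (parᵍ γ))) (≃-sym (parᵍ-sound γ))))
    parᵍ-sound (γ ᵈ)    = dual-cong (parᵍ-sound γ)
    parᵍ-sound (φ ¿)    X≐Y = ∩-cong (par-sound φ) X≐Y
    parᵍ-sound (φ ¡)    X≐Y = ≐-trans (∪-cong (par-sound φ) X≐Y) ∪≐∁[∁∩∁]

  mutual
    nf-sound : ∀ φ → ⟦ φ ⟧F ≐ ⟦ nf φ ⟧N
    nf-sound (atom p)  = ≐-refl
    nf-sound (neg φ)   = nf¬-sound φ
    nf-sound (φ ∨ ψ)   = ∪-cong (nf-sound φ) (nf-sound ψ)
    nf-sound (⟨ γ ⟩ φ) = nfᵍ-sound γ (nf-sound φ)

    nf¬-sound : ∀ φ → ∁ ⟦ φ ⟧F ≐ ⟦ nf¬ φ ⟧N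
    nf¬-sound (atom p)  = ≐-refl
    nf¬-sound (neg φ)   = ≐-trans (≐-sym ≐∁∁) (nf-sound φ)
    nf¬-sound (φ ∨ ψ)   = ≐-trans ∁-∪ (∩-cong (nf¬-sound φ) (nf¬-sound ψ))
    nf¬-sound (⟨ γ ⟩ φ) =
      ≐-trans (∁-cong (≃-refl (ÊF-mono γ) ≐∁∁)) (nfᵍᵈ-sound γ (nf¬-sound φ))

    nfᵍ-sound : ∀ γ → ÊF γ ≃ ÊN (nfᵍ γ)
    nfᵍ-sound (gatom g) = ≃-refl (mono g)
    nfᵍ-sound (γ ⨾ δ)  X≐Y = nfᵍ-sound γ (nfᵍ-sound δ X≐Y)
    nfᵍ-sound (γ ⊔g δ) X≐Y = ∪-cong (nfᵍ-sound γ X≐Y) (nfᵍ-sound δ X≐Y)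
    nfᵍ-sound (γ ⊓g δ) X≐Y = ∩-cong (nfᵍ-sound γ X≐Y) (nfᵍ-sound δ X≐Y)
    nfᵍ-sound (γ *)    = star-cong (ÊF-mono γ) (ÊN-mono (nfᵍ γ)) (nfᵍ-sound γ)
    nfᵍ-sound (γ ˣ)    = cross-cong (ÊF-mono γ) (ÊN-mono (nfᵍ γ)) (nfᵍ-sound γ)
    nfᵍ-sound (γ ᵈ)    = nfᵍᵈ-sound γ
    nfᵍ-sound (φ ¿)    X≐Y = ∩-cong (nf-sound φ) X≐Y
    nfᵍ-sound (φ ¡)    X≐Y = ∪-cong (nf-sound φ) X≐Y

    nfᵍᵈ-sound : ∀ γ → dual (ÊF γ) ≃ ÊN (nfᵍᵈ γ)
    nfᵍᵈ-sound (gatom g) = dual-cong (≃-refl (mono g))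
    nfᵍᵈ-sound (γ ⨾ δ)  X≐Y =
      ≐-trans (∁-cong (≃-refl (ÊF-mono γ) ≐∁∁)) (nfᵍᵈ-sound γ (nfᵍᵈ-sound δ X≐Y))
    nfᵍᵈ-sound (γ ⊔g δ) X≐Y = ≐-trans ∁-∪ (∩-cong (nfᵍᵈ-sound γ X≐Y) (nfᵍᵈ-sound δ X≐Y))
    nfᵍᵈ-sound (γ ⊓g δ) X≐Y = ≐-trans ∁-∩ (∪-cong (nfᵍᵈ-sound γ X≐Y) (nfᵍᵈ-sound δ X≐Y))
    nfᵍᵈ-sound (γ *)    = dual-star (ÊF-mono γ) (ÊN-mono (nfᵍᵈ γ)) (nfᵍᵈ-sound γ)
    nfᵍᵈ-sound (γ ˣ)    = dual-cross (ÊF-mono γ) (ÊN-mono (nfᵍᵈ γ)) (nfᵍᵈ-sound γ)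
    nfᵍᵈ-sound (γ ᵈ)    = ≃-trans (dual-involutive (ÊF-mono γ)) (nfᵍ-sound γ)
    nfᵍᵈ-sound (φ ¿)    X≐Y = ≐-trans ∁-∩ (∪-cong (nf¬-sound φ) (≐-trans (≐-sym ≐∁∁) X≐Y))
    nfᵍᵈ-sound (φ ¡)    X≐Y = ≐-trans ∁-∪ (∩-cong (nf¬-sound φ) (≐-trans (≐-sym ≐∁∁) X≐Y))

proposition1 : TruthPreservingTranslations
proposition1 = record
  { nf        = nf
  ; par       = par
  ; nf-sound  = λ lem M φ → ≐-sym (Soundness.nf-sound lem M φ)
  ; par-sound = Soundness.par-sound
  }
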